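{- Let $\mathcal{G}$ be an additive subgroup of $\mathbb{R}$, $n$ a positive integer, $c,m\in\mathcal{G}$ with $c>0$, $m\geq 0$, and $k\in\{0,\ldots,n-1\}$. Let $D:[n]\to\mathcal{G}$ be a chip configuration satisfying (C0) $D\geq 0$ and (C1) no $S\subseteq[n]$ with $0<|S|\leq k+1$ can legally fire in $D$. Let $g=(g_0,\ldots,g_{n-1})$ be the area vector of $D$ and $w(D)=(w_0,\ldots,w_{n-1})$ its label sequence. Let $p\in\{1,\ldots,n\}$ satisfy ($p=n$ or $g_p\leq c$) and $g_{p-1}>c$, and let $T=\{w_0,\ldots,w_{p-1}\}$. Then $\beta_T(D)$ has area vector $(g_p,\ldots,g_{n-1},g_0-c,\ldots,g_{p-1}-c)$.
   Context: $[n]=\{1,\ldots,n\}$. A chip configuration is a function $D:[n]\to\mathcal{G}$; $D\geq 0$ means $D(i)\geq 0$ for all $i$. For nonempty $S\subseteq[n]$ with $|S|=f$, $S$ can legally fire in $D$ iff $D(i)\geq m(n-f)+c$ for all $i\in S$. For nonempty $T\subseteq[n]$ with $|T|=p$, $\beta_T(D)$ is the configuration obtained from $D$ by increasing $D(i)$ by $m(n-p)+c$ for each $i\in T$ and decreasing $D(j)$ by $mp$ for each $j\in[n]\setminus T$. The label sequence $w(D)=(w_0,\ldots,w_{n-1})$ is the unique rearrangement of $1,\ldots,n$ with $D(w_0)\leq D(w_1)\leq\cdots\leq D(w_{n-1})$ and $w_i<w_{i+1}$ whenever $D(w_i)=D(w_{i+1})$. Writing $x_i=D(w_i)$, the area vector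 of $D$ is $(g_0,\ldots,g_{n-1})$ with $g_i=mi+c-x_i$. -}

module Defs where

open import Data.Nat as ℕ using (ℕ; zero; suc; _∸_)
open import Data.Fin using (Fin; toℕ)
open import Data.Fin.Subset using (Subset; _∈_; ∣_∣)
open import Data.Vec using (lookup)
open import Data.Bool using (true; false)
open import Data.Product using (_×_; ∃)
open import Relation.Binary.PropositionalEquality using (_≡_; _≢_)
open import Relation.Nullary using (¬_)
open import Function.Definitions using (Bijective)
open import Algebra.Structures using (IsAbelianGroup)
open import Relation.Binary.Structures using (IsTotalOrder)

times : {A : Set} → (A → A → A) → A → ℕ → A → A
times _+_ 0# zero    x = 0#
times _+_ 0# (suc k) x = x + times _+_ 0# k x

-- By Hölder's theorem these are exactly (up to isomorphism)
-- the additive subgroups of ℝ with the induced order.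
record ArchOrderedAbGroup : Set₁ where
  infixl 6 _+ᴳ_
  infix 4 _≤ᴳ_
  field
    Carrier        : Set
    _+ᴳ_            : Carrier → Carrier → Carrier
    0#             : Carrier
    -_             : Carrier → Carrier
    _≤ᴳ_            : Carrier → Carrier → Set
    isAbelianGroup : IsAbelianGroup _≡_ _+ᴳ_ 0# -_
    isTotalOrder   : IsTotalOrder _≡_ _≤ᴳ_
    +-mono-≤       : ∀ {x y} z → x ≤ᴳ y → x +ᴳ z ≤ᴳ y +ᴳ z

  infixl 6 _-ᴳ_
  _-ᴳ_ : Carrier → Carrier → Carrier
  x -ᴳ y = x +ᴳ (- y)

  infix 4 _<ᴳ_
  _<ᴳ_ : Carrier → Carrier → Set
  x <ᴳ y = (x ≤ᴳ y) × (x ≢ y)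

  infixr 7 _·_
  _·_ : ℕ → Carrier → Carrier
  k · x = times _+ᴳ_ 0# k x

  field
    archimedean : ∀ x y → 0# <ᴳ x → ∃ λ (k : ℕ) → y ≤ᴳ k · x

module ChipFiring (G : ArchOrderedAbGroup) (n : ℕ) (m c : ArchOrderedAbGroup.Carrier G) where
  open ArchOrderedAbGroup G

  Config : Set
  Config = Fin n → Carrier

  Nonneg : Config → Set
  Nonneg D = ∀ i → 0# ≤ᴳ D i

  CanFire : Subset n → Config → Set
  CanFire S D = ∀ i → i ∈ S → (n ∸ ∣ S ∣) · m +ᴳ c ≤ᴳ D i

  β : Subset n → Config → Config
  β T D i with lookup T i
  ... | true  = D i +ᴳ ((n ∸ ∣ T ∣) · m +ᴳ c)
  ... | false = D i -ᴳ ∣ T ∣ · m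

  -- w is the label sequence w(D): a rearrangement of [n] (bijection
  -- Fin n → Fin n, position ↦ label) with D(w_i) ≤ D(w_{i+1}) and
  -- w_i < w_{i+1} whenever D(w_i) = D(w_{i+1}).
  IsLabelSeq : Config → (Fin n → Fin n) → Set
  IsLabelSeq D w =
    Bijective _≡_ _≡_ w ×
    (∀ (i j : Fin n) → toℕ j ≡ suc (toℕ i) →
       (D (w i) ≤ᴳ D (w j)) × (D (w i) ≡ D (w j) → toℕ (w i) ℕ.< toℕ (w j)))

  area : Config → (Fin n → Fin n) → Fin n → Carrier
  area D w i = toℕ i · m +ᴳ c -ᴳ D (w i)

{-# OPTIONS --safe #-}
module Submission where

-- (C1) for singletons bounds every D(l) by m(n-1) + c. Firing T adds m(n-p) + c to the labels
-- of T and removes mp from the others, so afterwards every label outside T holds fewer chips than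
-- every label of T, while within each block all labels are shifted by the same amount. Hence
-- w(β_T(D)) = (w_p, …, w_{n-1}, w_0, …, w_{p-1}), because two bijective enumerations of [n] that
-- increase for the same strict order coincide; the area vector is read off from the two shifts.

open import Defs
open import Algebra.Bundles using (AbelianGroup)
open import Algebra.Structures using (IsAbelianGroup)
import Algebra.Properties.AbelianGroup as AbelianGroupProperties
import Algebra.Properties.CommutativeMonoid.Sum as Sum
import Algebra.Solver.CommutativeMonoid as CommutativeMonoidSolver
open import Data.Bool using (Bool; true; false; if_then_else_)
open import Data.Bool.Properties using (¬-not)
open import Data.Empty using (⊥-elim)
open import Data.Fin as Fin using (Fin; suc; toℕ; fromℕ; fromℕ<; inject₁)
open import Data.Fin.Induction using (<-weakInduction; >-weakInduction)
open import Data.Fin.Properties using (toℕ-injective; toℕ<n; toℕ-fromℕ<; toℕ-inject₁; ≤fromℕ; <-cmp)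
open import Data.Fin.Subset using (Subset; _∈_; _∉_; ∣_∣; ⁅_⁆)
open import Data.Fin.Subset.Properties using (x∈⁅y⁆⇒x≡y; ∣⁅x⁆∣≡1)
open import Data.Nat using (ℕ; zero; suc; _+_; _∸_; _≤_; _<_; z≤n; s≤s; s≤s⁻¹; _<ᵇ_)
import Data.Nat.Properties as ℕ
open import Data.Product using (_×_; ∃; _,_; proj₁; proj₂)
open import Data.Sum using (_⊎_; inj₁; inj₂)
open import Data.Vec using ([]; _∷_; lookup)
open import Data.Vec.Properties using ([]=⇒lookup; lookup⇒[]=)
open import Function using (_∘_)
open import Function.Bundles using (_⇔_; Equivalence; mk⤖)
open import Function.Definitions using (Bijective; Surjective)
open import Function.Properties.Bijection using (⤖⇒↔)
open import Relation.Binary.Core using (Rel; _Preserves_⟶_)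
open import Relation.Binary.Definitions using (Transitive; Asymmetric; tri<; tri≈; tri>)
open import Relation.Binary.PropositionalEquality
  using (_≡_; refl; sym; trans; cong; cong₂; subst; subst₂; module ≡-Reasoning)
open import Relation.Binary.Structures using (IsTotalOrder)
import Relation.Binary.Construct.NonStrictToStrict as NonStrictToStrict
open import Relation.Binary.Bundles using (Poset)
import Relation.Binary.Reasoning.PartialOrder as PartialOrderReasoning
open import Relation.Nullary using (¬_; yes; no)
open import Relation.Nullary.Reflects using (ofʸ; ofⁿ)

inject₁<suc : ∀ {n} (i : Fin n) → inject₁ i Fin.< suc i
inject₁<suc i = s≤s (ℕ.≤-reflexive (toℕ-inject₁ i))

strictMono⇒inflationary : ∀ {n} (f : Fin n → Fin n) → f Preserves Fin._<_ ⟶ Fin._<_ →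
                          ∀ i → i Fin.≤ f i
strictMono⇒inflationary {suc n} f mono = <-weakInduction (λ i → i Fin.≤ f i) z≤n step
  where
  step : ∀ i → inject₁ i Fin.≤ f (inject₁ i) → suc i Fin.≤ f (suc i)
  step i ih = ℕ.≤-<-trans (subst (_≤ toℕ (f (inject₁ i))) (toℕ-inject₁ i) ih) (mono (inject₁<suc i))

strictMono⇒deflationary : ∀ {n} (f : Fin n → Fin n) → f Preserves Fin._<_ ⟶ Fin._<_ →
                          ∀ i → f i Fin.≤ i
strictMono⇒deflationary {suc n} f mono = >-weakInduction (λ i → f i Fin.≤ i) (≤fromℕ (f (fromℕ n))) step
  where
  step : ∀ i → f (suc i) Fin.≤ suc i → f (inject₁ i) Fin.≤ inject₁ i
  step i ih = subst (toℕ (f (inject₁ i)) ≤_) (sym (toℕ-inject₁ i))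
                    (s≤s⁻¹ (ℕ.<-≤-trans (mono (inject₁<suc i)) ih))

strictMono⇒≗id : ∀ {n} (f : Fin n → Fin n) → f Preserves Fin._<_ ⟶ Fin._<_ → ∀ i → f i ≡ i
strictMono⇒≗id f mono i =
  toℕ-injective (ℕ.≤-antisym (strictMono⇒deflationary f mono i) (strictMono⇒inflationary f mono i))

module _ {a ℓ} {A : Set a} {_≺_ : Rel A ℓ} where

  consecutive⇒increasing : Transitive _≺_ → ∀ {n} (f : Fin n → A) →
                           (∀ i j → toℕ j ≡ suc (toℕ i) → f i ≺ f j) →
                           f Preserves Fin._<_ ⟶ _≺_
  consecutive⇒increasing ≺-trans {suc n} f step {i} {j} =
    <-weakInduction (λ j → i Fin.< j → f i ≺ f j) (λ ()) extend j
    where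
    last : ∀ j → f (inject₁ j) ≺ f (suc j)
    last j = step (inject₁ j) (suc j) (sym (cong (1 +_) (toℕ-inject₁ j)))
    extend : ∀ j → (i Fin.< inject₁ j → f i ≺ f (inject₁ j)) → i Fin.< suc j → f i ≺ f (suc j)
    extend j ih i<1+j with ℕ.m≤n⇒m<n∨m≡n (s≤s⁻¹ i<1+j)
    ... | inj₁ i<j = ≺-trans (ih (subst (toℕ i <_) (sym (toℕ-inject₁ j)) i<j)) (last j)
    ... | inj₂ i≡j =
      subst (λ i → f i ≺ f (suc j)) (toℕ-injective (trans (toℕ-inject₁ j) (sym i≡j))) (last j)

  increasing-enumeration-unique : Asymmetric _≺_ → ∀ {n} (w v : Fin n → A) →
                                  Surjective _≡_ _≡_ w →
                                  w Preserves Fin._<_ ⟶ _≺_ → v Preserves Fin._<_ ⟶ _≺_ →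
                                  ∀ i → w i ≡ v i
  increasing-enumeration-unique asym {n} w v surj w↑ v↑ i =
    trans (cong w (sym (strictMono⇒≗id σ σ↑ i))) (w∘σ≗v i)
    where
    σ : Fin n → Fin n
    σ i = proj₁ (surj (v i))
    w∘σ≗v : ∀ i → w (σ i) ≡ v i
    w∘σ≗v i = proj₂ (surj (v i)) refl
    σ↑ : σ Preserves Fin._<_ ⟶ Fin._<_
    σ↑ {i} {j} i<j with <-cmp (σ i) (σ j)
    ... | tri< σi<σj _ _ = σi<σj
    ... | tri≈ _ σi≡σj _ = ⊥-elim (asym (v↑ i<j) (subst₂ _≺_ vi≡vj (sym vi≡vj) (v↑ i<j)))
      where vi≡vj = trans (sym (w∘σ≗v i)) (trans (cong w σi≡σj) (w∘σ≗v j))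
    ... | tri> _ _ σj<σi = ⊥-elim (asym (v↑ i<j) (subst₂ _≺_ (w∘σ≗v j) (w∘σ≗v i) (w↑ σj<σi)))

indicator : Bool → ℕ
indicator b = if b then 1 else 0

open Sum ℕ.+-0-commutativeMonoid using (sum; sum-permute; sum-cong-≗)

∣p∣≡∑indicator : ∀ {n} (T : Subset n) → ∣ T ∣ ≡ sum (indicator ∘ lookup T)
∣p∣≡∑indicator []          = refl
∣p∣≡∑indicator (true ∷ T)  = cong (1 +_) (∣p∣≡∑indicator T)
∣p∣≡∑indicator (false ∷ T) = ∣p∣≡∑indicator T

∑indicator[<p]≡p : ∀ {n p} → p ≤ n → sum {n} (λ j → indicator (toℕ j <ᵇ p)) ≡ p
∑indicator[<p]≡p {zero}          z≤n       = refl
∑indicator[<p]≡p {suc n} {zero}  z≤n       = ∑indicator[<p]≡p {n} z≤n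
∑indicator[<p]≡p {suc n} {suc p} (s≤s p≤n) = cong (1 +_) (∑indicator[<p]≡p p≤n)

module _ {n} {w : Fin n → Fin n} (w-bij : Bijective _≡_ _≡_ w) {p} {T : Subset n}
         (T-def : ∀ i → i ∈ T ⇔ ∃ λ j → toℕ j < p × w j ≡ i) where

  w[<p]∈T : ∀ {j} → toℕ j < p → w j ∈ T
  w[<p]∈T {j} j<p = Equivalence.from (T-def (w j)) (j , j<p , refl)

  w[≥p]∉T : ∀ {j} → p ≤ toℕ j → w j ∉ T
  w[≥p]∉T {j} p≤j wj∈T with Equivalence.to (T-def (w j)) wj∈T
  ... | j′ , j′<p , wj′≡wj = ℕ.<⇒≱ (subst (λ j → toℕ j < p) (proj₁ w-bij wj′≡wj) j′<p) p≤j

  ∣T∣≡p : p ≤ n → ∣ T ∣ ≡ p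
  ∣T∣≡p p≤n = begin
    ∣ T ∣                                    ≡⟨ ∣p∣≡∑indicator T ⟩
    sum (indicator ∘ lookup T)               ≡⟨ sum-permute _ (⤖⇒↔ (mk⤖ w-bij)) ⟩
    sum (indicator ∘ lookup T ∘ w)           ≡⟨ sum-cong-≗ indicator-image ⟩
    sum {n} (λ j → indicator (toℕ j <ᵇ p))   ≡⟨ ∑indicator[<p]≡p p≤n ⟩
    p                                        ∎
    where
    open ≡-Reasoning
    indicator-image : ∀ j → indicator (lookup T (w j)) ≡ indicator (toℕ j <ᵇ p)
    indicator-image j with toℕ j <ᵇ p | ℕ.<ᵇ-reflects-< (toℕ j) p
    ... | true  | ofʸ j<p = cong indicator ([]=⇒lookup (w[<p]∈T j<p))
    ... | false | ofⁿ j≮p = cong indicator (¬-not (w[≥p]∉T (ℕ.≮⇒≥ j≮p) ∘ lookup⇒[]= (w j) T))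

module OrderedGroupProperties (G : ArchOrderedAbGroup) where
  open ArchOrderedAbGroup G
  open IsAbelianGroup isAbelianGroup using (comm; identityˡ; identityʳ; inverseʳ)
  open IsTotalOrder isTotalOrder using (total; reflexive) renaming (trans to ≤-trans)

  abelianGroup : AbelianGroup _ _
  abelianGroup = record
    { Carrier = Carrier ; _≈_ = _≡_ ; _∙_ = _+ᴳ_ ; ε = 0# ; _⁻¹ = -_ ; isAbelianGroup = isAbelianGroup }

  open AbelianGroupProperties abelianGroup public using (∙-cancelʳ)
  open AbelianGroupProperties abelianGroup using (⁻¹-∙-comm; ⁻¹-involutive)
  open CommutativeMonoidSolver (AbelianGroup.commutativeMonoid abelianGroup) using (solve; _⊜_; _⊕_)

  poset : Poset _ _ _
  poset = record { isPartialOrder = IsTotalOrder.isPartialOrder isTotalOrder }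

  module ≤-Reasoning = PartialOrderReasoning poset

  ≰⇒> : ∀ {x y} → ¬ (x ≤ᴳ y) → y <ᴳ x
  ≰⇒> = NonStrictToStrict.≰⇒> _≡_ _≤ᴳ_ sym reflexive total

  +-monoˡ-< : ∀ {x y} z → x <ᴳ y → x +ᴳ z <ᴳ y +ᴳ z
  +-monoˡ-< z (x≤y , x≢y) = +-mono-≤ z x≤y , x≢y ∘ ∙-cancelʳ z _ _

  x≤y+x : ∀ x {y} → 0# ≤ᴳ y → x ≤ᴳ y +ᴳ x
  x≤y+x x {y} 0≤y = subst (_≤ᴳ y +ᴳ x) (identityˡ x) (+-mono-≤ x 0≤y)

  x≤x+y : ∀ x {y} → 0# ≤ᴳ y → x ≤ᴳ x +ᴳ y
  x≤x+y x {y} 0≤y = subst (x ≤ᴳ_) (comm y x) (x≤y+x x 0≤y)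

  ·-homo-+ : ∀ a b x → (a + b) · x ≡ a · x +ᴳ b · x
  ·-homo-+ zero    b x = sym (identityˡ (b · x))
  ·-homo-+ (suc a) b x = trans (cong (x +ᴳ_) (·-homo-+ a b x)) (sym (assoc x (a · x) (b · x)))
    where open IsAbelianGroup isAbelianGroup using (assoc)

  ·-nonneg : ∀ a {x} → 0# ≤ᴳ x → 0# ≤ᴳ a · x
  ·-nonneg zero  0≤x = reflexive refl
  ·-nonneg (suc a) 0≤x = ≤-trans 0≤x (x≤x+y _ (·-nonneg a 0≤x))

  ·-monoˡ-≤ : ∀ {a b x} → 0# ≤ᴳ x → a ≤ b → a · x ≤ᴳ b · x
  ·-monoˡ-≤ {a} {b} {x} 0≤x a≤b = subst (λ k → a · x ≤ᴳ k · x) (ℕ.m+[n∸m]≡n a≤b)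
    (subst (a · x ≤ᴳ_) (sym (·-homo-+ a (b ∸ a) x)) (x≤x+y (a · x) (·-nonneg (b ∸ a) 0≤x)))

  x+y+z-y≡x+z : ∀ x y z → x +ᴳ y +ᴳ z -ᴳ y ≡ x +ᴳ z
  x+y+z-y≡x+z x y z = begin
    x +ᴳ y +ᴳ z +ᴳ - y
      ≡⟨ solve 4 (λ x y z y′ → ((x ⊕ y) ⊕ z) ⊕ y′ ⊜ (x ⊕ z) ⊕ (y ⊕ y′)) refl x y z (- y) ⟩
    x +ᴳ z +ᴳ (y +ᴳ - y)     ≡⟨ cong (x +ᴳ z +ᴳ_) (inverseʳ y) ⟩
    x +ᴳ z +ᴳ 0#             ≡⟨ identityʳ (x +ᴳ z) ⟩
    x +ᴳ z                   ∎
    where open ≡-Reasoning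

  x+y-[z-w]≡x+w+y-z : ∀ x y z w → x +ᴳ y -ᴳ (z -ᴳ w) ≡ x +ᴳ w +ᴳ y -ᴳ z
  x+y-[z-w]≡x+w+y-z x y z w = begin
    x +ᴳ y +ᴳ - (z +ᴳ - w)   ≡⟨ cong (x +ᴳ y +ᴳ_) (sym (⁻¹-∙-comm z (- w))) ⟩
    x +ᴳ y +ᴳ (- z +ᴳ - - w) ≡⟨ cong (λ w′ → x +ᴳ y +ᴳ (- z +ᴳ w′)) (⁻¹-involutive w) ⟩
    x +ᴳ y +ᴳ (- z +ᴳ w)
      ≡⟨ solve 4 (λ x y z′ w → (x ⊕ y) ⊕ (z′ ⊕ w) ⊜ ((x ⊕ w) ⊕ y) ⊕ z′) refl x y (- z) w ⟩
    x +ᴳ w +ᴳ y -ᴳ z         ∎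
    where open ≡-Reasoning

  x+y+z-[w+[y+z]]≡x+z-w-z : ∀ x y z w → x +ᴳ y +ᴳ z -ᴳ (w +ᴳ (y +ᴳ z)) ≡ x +ᴳ z -ᴳ w -ᴳ z
  x+y+z-[w+[y+z]]≡x+z-w-z x y z w = begin
    x +ᴳ y +ᴳ z +ᴳ - (w +ᴳ (y +ᴳ z))
      ≡⟨ cong (x +ᴳ y +ᴳ z +ᴳ_) -[w+[y+z]]≡-w+[-y+-z] ⟩
    x +ᴳ y +ᴳ z +ᴳ (- w +ᴳ (- y +ᴳ - z))
      ≡⟨ solve 6 (λ x y z w′ y′ z′ → ((x ⊕ y) ⊕ z) ⊕ (w′ ⊕ (y′ ⊕ z′)) ⊜ (((x ⊕ z) ⊕ w′) ⊕ z′) ⊕ (y ⊕ y′))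
                 refl x y z (- w) (- y) (- z) ⟩
    x +ᴳ z -ᴳ w -ᴳ z +ᴳ (y +ᴳ - y)   ≡⟨ cong (x +ᴳ z -ᴳ w -ᴳ z +ᴳ_) (inverseʳ y) ⟩
    x +ᴳ z -ᴳ w -ᴳ z +ᴳ 0#           ≡⟨ identityʳ _ ⟩
    x +ᴳ z -ᴳ w -ᴳ z                 ∎
    where
    open ≡-Reasoning
    -[w+[y+z]]≡-w+[-y+-z] : - (w +ᴳ (y +ᴳ z)) ≡ - w +ᴳ (- y +ᴳ - z)
    -[w+[y+z]]≡-w+[-y+-z] = sym (trans (cong (- w +ᴳ_) (⁻¹-∙-comm y z)) (⁻¹-∙-comm w (y +ᴳ z)))

module Rotation {n p : ℕ} (p≤n : p ≤ n) where

  RotatesTo : Fin n → Fin n → Set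
  RotatesTo i j = toℕ j ≡ toℕ i + p ⊎ toℕ j + n ≡ toℕ i + p

  rotate : ∀ i → ∃ (RotatesTo i)
  rotate i with toℕ i + p ℕ.<? n
  ... | yes i+p<n = fromℕ< i+p<n , inj₁ (toℕ-fromℕ< i+p<n)
  ... | no  i+p≮n = fromℕ< i+p∸n<n , inj₂ (trans (cong (_+ n) (toℕ-fromℕ< i+p∸n<n)) (ℕ.m∸n+n≡m n≤i+p))
    where
    n≤i+p : n ≤ toℕ i + p
    n≤i+p = ℕ.≮⇒≥ i+p≮n
    i+p∸n<n : toℕ i + p ∸ n < n
    i+p∸n<n = ℕ.+-cancelʳ-< n _ _ (subst (_< n + n) (sym (ℕ.m∸n+n≡m n≤i+p)) (ℕ.+-mono-<-≤ (toℕ<n i) p≤n))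

  RotatesTo-functional : ∀ {i j j′} → RotatesTo i j → RotatesTo i j′ → j ≡ j′
  RotatesTo-functional (inj₁ j≡i+p) (inj₁ j′≡i+p) = toℕ-injective (trans j≡i+p (sym j′≡i+p))
  RotatesTo-functional (inj₂ j+n≡i+p) (inj₂ j′+n≡i+p) =
    toℕ-injective (ℕ.+-cancelʳ-≡ n _ _ (trans j+n≡i+p (sym j′+n≡i+p)))
  RotatesTo-functional {j = j} {j′} (inj₁ j≡i+p) (inj₂ j′+n≡i+p) =
    ⊥-elim (ℕ.<⇒≱ (toℕ<n j) (subst (n ≤_) (trans j′+n≡i+p (sym j≡i+p)) (ℕ.m≤n+m n (toℕ j′))))
  RotatesTo-functional (inj₂ j+n≡i+p) (inj₁ j′≡i+p) =
    sym (RotatesTo-functional (inj₁ j′≡i+p) (inj₂ j+n≡i+p))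

  no-wrap⇒p≤ : ∀ {i j : Fin n} → toℕ j ≡ toℕ i + p → p ≤ toℕ j
  no-wrap⇒p≤ {i} j≡i+p = subst (p ≤_) (sym j≡i+p) (ℕ.m≤n+m p (toℕ i))

  wrap⇒<p : ∀ {i j : Fin n} → toℕ j + n ≡ toℕ i + p → toℕ j < p
  wrap⇒<p {i} j+n≡i+p =
    ℕ.+-cancelʳ-< n _ _ (subst₂ _<_ (sym j+n≡i+p) (ℕ.+-comm n p) (ℕ.+-monoˡ-< p (toℕ<n i)))

  -- Positions below p (the labels of T) are "inside"; rotating by p puts the outside block first.
  data RotatedOrder (j j′ : Fin n) : Set where
    both-outside          : p ≤ toℕ j → j Fin.< j′ → RotatedOrder j j′
    both-inside           : toℕ j′ < p → j Fin.< j′ → RotatedOrder j j′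
    outside-before-inside : p ≤ toℕ j → toℕ j′ < p → RotatedOrder j j′

  rotate-mono : ∀ {i i′ j j′} → i Fin.< i′ → RotatesTo i j → RotatesTo i′ j′ → RotatedOrder j j′
  rotate-mono i<i′ (inj₁ j≡i+p) (inj₁ j′≡i′+p) =
    both-outside (no-wrap⇒p≤ j≡i+p) (subst₂ _<_ (sym j≡i+p) (sym j′≡i′+p) (ℕ.+-monoˡ-< p i<i′))
  rotate-mono i<i′ (inj₂ j+n≡i+p) (inj₂ j′+n≡i′+p) =
    both-inside (wrap⇒<p j′+n≡i′+p)
      (ℕ.+-cancelʳ-< n _ _ (subst₂ _<_ (sym j+n≡i+p) (sym j′+n≡i′+p) (ℕ.+-monoˡ-< p i<i′)))
  rotate-mono i<i′ (inj₁ j≡i+p) (inj₂ j′+n≡i′+p) =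
    outside-before-inside (no-wrap⇒p≤ j≡i+p) (wrap⇒<p j′+n≡i′+p)
  rotate-mono {j = j} {j′} i<i′ (inj₂ j+n≡i+p) (inj₁ j′≡i′+p) =
    ⊥-elim (ℕ.<⇒≱ (toℕ<n j′) (ℕ.≤-trans (ℕ.m≤n+m n (toℕ j))
      (ℕ.<⇒≤ (subst₂ _<_ (sym j+n≡i+p) (sym j′≡i′+p) (ℕ.+-monoˡ-< p i<i′)))))

module ChipFiringProperties (G : ArchOrderedAbGroup) {n : ℕ} {m c : ArchOrderedAbGroup.Carrier G} where
  open ArchOrderedAbGroup G
  open ChipFiring G n m c
  open OrderedGroupProperties G
  open IsTotalOrder isTotalOrder using (antisym) renaming (trans to ≤-trans)

  _≺⟨_⟩_ : Fin n → Config → Fin n → Set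
  l ≺⟨ D ⟩ l′ = D l ≤ᴳ D l′ × (D l ≡ D l′ → toℕ l < toℕ l′)

  ≺-trans : ∀ D → Transitive _≺⟨ D ⟩_
  ≺-trans D (l≤l′ , tie₁) (l′≤l″ , tie₂) = ≤-trans l≤l′ l′≤l″ , λ Dl≡Dl″ →
    let Dl≡Dl′ = antisym l≤l′ (subst (D _ ≤ᴳ_) (sym Dl≡Dl″) l′≤l″)
    in ℕ.<-trans (tie₁ Dl≡Dl′) (tie₂ (trans (sym Dl≡Dl′) Dl≡Dl″))

  ≺-asym : ∀ D → Asymmetric _≺⟨ D ⟩_
  ≺-asym D (l≤l′ , tie₁) (l′≤l , tie₂) = ℕ.<-asym (tie₁ Dl≡Dl′) (tie₂ (sym Dl≡Dl′))
    where Dl≡Dl′ = antisym l≤l′ l′≤l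

  <⇒≺ : ∀ {D l l′} → D l <ᴳ D l′ → l ≺⟨ D ⟩ l′
  <⇒≺ (Dl≤Dl′ , Dl≢Dl′) = Dl≤Dl′ , ⊥-elim ∘ Dl≢Dl′

  ≺-translate : ∀ {D E l l′} z → E l ≡ D l +ᴳ z → E l′ ≡ D l′ +ᴳ z → l ≺⟨ D ⟩ l′ → l ≺⟨ E ⟩ l′
  ≺-translate z El≡Dl+z El′≡Dl′+z (Dl≤Dl′ , tie) =
    subst₂ _≤ᴳ_ (sym El≡Dl+z) (sym El′≡Dl′+z) (+-mono-≤ z Dl≤Dl′) ,
    λ El≡El′ → tie (∙-cancelʳ z _ _ (trans (sym El≡Dl+z) (trans El≡El′ El′≡Dl′+z)))

  labelSeq-increasing : ∀ {D w} → IsLabelSeq D w → w Preserves Fin._<_ ⟶ _≺⟨ D ⟩_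
  labelSeq-increasing {D} {w} (_ , consecutive) =
    consecutive⇒increasing {_≺_ = _≺⟨ D ⟩_} (≺-trans D) w consecutive

  labelSeq-unique : ∀ {D w v} → IsLabelSeq D w → v Preserves Fin._<_ ⟶ _≺⟨ D ⟩_ → ∀ i → w i ≡ v i
  labelSeq-unique {D} {w} {v} w-label@((_ , surj) , _) =
    increasing-enumeration-unique {_≺_ = _≺⟨ D ⟩_} (≺-asym D) w v surj (labelSeq-increasing {D} w-label)

  β-∈ : ∀ {T D l} → l ∈ T → β T D l ≡ D l +ᴳ ((n ∸ ∣ T ∣) · m +ᴳ c)
  β-∈ l∈T rewrite []=⇒lookup l∈T = refl

  β-∉ : ∀ {T D l} → l ∉ T → β T D l ≡ D l -ᴳ ∣ T ∣ · m
  β-∉ {T} {l = l} l∉T rewrite ¬-not (l∉T ∘ lookup⇒[]= l T) = refl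

  ¬CanFire⁅l⁆⇒<threshold : ∀ {D l} → ¬ CanFire ⁅ l ⁆ D → D l <ᴳ (n ∸ 1) · m +ᴳ c
  ¬CanFire⁅l⁆⇒<threshold {D} {l} ¬fire = ≰⇒> λ threshold≤Dl → ¬fire λ i i∈⁅l⁆ →
    subst₂ (λ s l′ → (n ∸ s) · m +ᴳ c ≤ᴳ D l′) (sym (∣⁅x⁆∣≡1 l)) (sym (x∈⁅y⁆⇒x≡y l i∈⁅l⁆)) threshold≤Dl

  module FireInitialSegment
    (m≥0 : 0# ≤ᴳ m) {D : Config} (D≥0 : Nonneg D)
    (below-threshold : ∀ l → D l <ᴳ (n ∸ 1) · m +ᴳ c)
    {w : Fin n → Fin n} (w-label : IsLabelSeq D w)
    {p : ℕ} (p≤n : p ≤ n) {T : Subset n}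
    (T-def : ∀ i → i ∈ T ⇔ ∃ λ j → toℕ j < p × w j ≡ i)
    where
    open Rotation p≤n

    E : Config
    E = β T D

    w-bij : Bijective _≡_ _≡_ w
    w-bij = proj₁ w-label

    E-inside : ∀ {j} → toℕ j < p → E (w j) ≡ D (w j) +ᴳ ((n ∸ p) · m +ᴳ c)
    E-inside {j} j<p = trans (β-∈ (w[<p]∈T w-bij T-def j<p))
                             (cong (λ s → D (w j) +ᴳ ((n ∸ s) · m +ᴳ c)) (∣T∣≡p w-bij T-def p≤n))

    E-outside : ∀ {j} → p ≤ toℕ j → E (w j) ≡ D (w j) -ᴳ p · m
    E-outside {j} p≤j = trans (β-∉ (w[≥p]∉T w-bij T-def p≤j))
                              (cong (λ s → D (w j) -ᴳ s · m) (∣T∣≡p w-bij T-def p≤n))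

    outside<inside : ∀ {j j′} → p ≤ toℕ j → toℕ j′ < p → E (w j) <ᴳ E (w j′)
    outside<inside {j} {j′} p≤j j′<p =
      subst₂ _<ᴳ_ (sym (E-outside p≤j)) (sym (E-inside j′<p)) (begin-strict
      D (w j) -ᴳ P                   <⟨ +-monoˡ-< (- P) (below-threshold (w j)) ⟩
      (n ∸ 1) · m +ᴳ c -ᴳ P          ≤⟨ +-mono-≤ (- P) (+-mono-≤ c (·-monoˡ-≤ m≥0 n∸1≤[n∸p]+p)) ⟩
      (n ∸ p + p) · m +ᴳ c -ᴳ P      ≡⟨ cong (λ x → x +ᴳ c -ᴳ P) (·-homo-+ (n ∸ p) p m) ⟩
      N +ᴳ P +ᴳ c -ᴳ P               ≡⟨ x+y+z-y≡x+z N P c ⟩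
      N +ᴳ c                         ≤⟨ x≤y+x (N +ᴳ c) (D≥0 (w j′)) ⟩
      D (w j′) +ᴳ (N +ᴳ c)           ∎)
      where
      open ≤-Reasoning
      N = (n ∸ p) · m
      P = p · m
      n∸1≤[n∸p]+p : n ∸ 1 ≤ n ∸ p + p
      n∸1≤[n∸p]+p = subst (n ∸ 1 ≤_) (sym (ℕ.m∸n+n≡m p≤n)) (ℕ.m∸n≤m n 1)

    rotatedOrder⇒≺ : ∀ {j j′} → RotatedOrder j j′ → w j ≺⟨ E ⟩ w j′
    rotatedOrder⇒≺ (both-outside p≤j j<j′) =
      ≺-translate {D} {E} _ (E-outside p≤j) (E-outside (ℕ.≤-trans p≤j (ℕ.<⇒≤ j<j′)))
                  (labelSeq-increasing {D} w-label j<j′)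
    rotatedOrder⇒≺ (both-inside j′<p j<j′) =
      ≺-translate {D} {E} _ (E-inside (ℕ.<-trans j<j′ j′<p)) (E-inside j′<p)
                  (labelSeq-increasing {D} w-label j<j′)
    rotatedOrder⇒≺ (outside-before-inside p≤j j′<p) = <⇒≺ {E} (outside<inside p≤j j′<p)

    rotated : Fin n → Fin n
    rotated i = w (proj₁ (rotate i))

    rotated-increasing : rotated Preserves Fin._<_ ⟶ _≺⟨ E ⟩_
    rotated-increasing {i} {i′} i<i′ =
      rotatedOrder⇒≺ (rotate-mono i<i′ (proj₂ (rotate i)) (proj₂ (rotate i′)))

    labelSeq-β : ∀ {w′ i j} → IsLabelSeq E w′ → RotatesTo i j → w′ i ≡ w j
    labelSeq-β {i = i} w′-label i↦j =
      trans (labelSeq-unique {E} w′-label rotated-increasing i)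
            (cong w (RotatesTo-functional (proj₂ (rotate i)) i↦j))

    area-β-no-wrap : ∀ {w′} → IsLabelSeq E w′ → ∀ i j → toℕ j ≡ toℕ i + p →
                     area E w′ i ≡ area D w j
    area-β-no-wrap {w′} w′-label i j j≡i+p = begin
      toℕ i · m +ᴳ c -ᴳ E (w′ i)
        ≡⟨ cong (λ l → toℕ i · m +ᴳ c -ᴳ E l) (labelSeq-β w′-label (inj₁ j≡i+p)) ⟩
      toℕ i · m +ᴳ c -ᴳ E (w j)
        ≡⟨ cong (toℕ i · m +ᴳ c -ᴳ_) (E-outside (no-wrap⇒p≤ j≡i+p)) ⟩
      toℕ i · m +ᴳ c -ᴳ (X -ᴳ p · m)
        ≡⟨ x+y-[z-w]≡x+w+y-z (toℕ i · m) c X (p · m) ⟩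
      toℕ i · m +ᴳ p · m +ᴳ c -ᴳ X
        ≡⟨ cong (λ x → x +ᴳ c -ᴳ X) (sym (·-homo-+ (toℕ i) p m)) ⟩
      (toℕ i + p) · m +ᴳ c -ᴳ X
        ≡⟨ cong (λ k → k · m +ᴳ c -ᴳ X) (sym j≡i+p) ⟩
      toℕ j · m +ᴳ c -ᴳ X
        ∎
      where
      open ≡-Reasoning
      X = D (w j)

    area-β-wrap : ∀ {w′} → IsLabelSeq E w′ → ∀ i j → toℕ j + n ≡ toℕ i + p →
                  area E w′ i ≡ area D w j -ᴳ c
    area-β-wrap {w′} w′-label i j j+n≡i+p = begin
      toℕ i · m +ᴳ c -ᴳ E (w′ i)
        ≡⟨ cong (λ l → toℕ i · m +ᴳ c -ᴳ E l) (labelSeq-β w′-label (inj₂ j+n≡i+p)) ⟩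
      toℕ i · m +ᴳ c -ᴳ E (w j)
        ≡⟨ cong₂ (λ k x → k · m +ᴳ c -ᴳ x) i≡j+[n∸p] (E-inside (wrap⇒<p j+n≡i+p)) ⟩
      (toℕ j + (n ∸ p)) · m +ᴳ c -ᴳ (X +ᴳ (N +ᴳ c))
        ≡⟨ cong (λ x → x +ᴳ c -ᴳ (X +ᴳ (N +ᴳ c))) (·-homo-+ (toℕ j) (n ∸ p) m) ⟩
      toℕ j · m +ᴳ N +ᴳ c -ᴳ (X +ᴳ (N +ᴳ c))
        ≡⟨ x+y+z-[w+[y+z]]≡x+z-w-z (toℕ j · m) N c X ⟩
      toℕ j · m +ᴳ c -ᴳ X -ᴳ c
        ∎
      where
      open ≡-Reasoning
      X = D (w j)
      N = (n ∸ p) · m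
      i≡j+[n∸p] : toℕ i ≡ toℕ j + (n ∸ p)
      i≡j+[n∸p] = ℕ.+-cancelʳ-≡ p _ _ (begin
        toℕ i + p               ≡⟨ sym j+n≡i+p ⟩
        toℕ j + n               ≡⟨ cong (toℕ j +_) (sym (ℕ.m∸n+n≡m p≤n)) ⟩
        toℕ j + (n ∸ p + p)     ≡⟨ sym (ℕ.+-assoc (toℕ j) (n ∸ p) p) ⟩
        toℕ j + (n ∸ p) + p     ∎)

lemma4p4 : (G : ArchOrderedAbGroup) → let open ArchOrderedAbGroup G in
    (n : ℕ) → 0 < n → (c m : Carrier) → 0# <ᴳ c → 0# ≤ᴳ m →
    (k : ℕ) → k < n →
    let open ChipFiring G n m c in
    (D : Config) → Nonneg D →
    (∀ (S : Subset n) → 0 < ∣ S ∣ → ∣ S ∣ ≤ suc k → ¬ CanFire S D) →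
    (w : Fin n → Fin n) → IsLabelSeq D w →
    (p : ℕ) → 1 ≤ p → p ≤ n →
    (p ≡ n ⊎ (∀ (j : Fin n) → toℕ j ≡ p → area D w j ≤ᴳ c)) →
    (∀ (j : Fin n) → suc (toℕ j) ≡ p → c <ᴳ area D w j) →
    (T : Subset n) → (∀ (i : Fin n) → (i ∈ T) ⇔ (∃ λ (j : Fin n) → (toℕ j < p) × (w j ≡ i))) →
    (w′ : Fin n → Fin n) → IsLabelSeq (β T D) w′ →
    (∀ (i j : Fin n) → toℕ j ≡ toℕ i + p → area (β T D) w′ i ≡ area D w j) ×
    (∀ (i j : Fin n) → toℕ j + n ≡ toℕ i + p → area (β T D) w′ i ≡ area D w j -ᴳ c)
lemma4p4 G n _ c m _ m≥0 k _ D D≥0 no-small-firing w w-label p _ p≤n _ _ T T-def w′ w′-label =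
  area-β-no-wrap w′-label , area-β-wrap w′-label
  where
  open ArchOrderedAbGroup G
  open ChipFiringProperties G {n} {m} {c}
  below-threshold : ∀ l → D l <ᴳ (n ∸ 1) · m +ᴳ c
  below-threshold l = ¬CanFire⁅l⁆⇒<threshold (no-small-firing ⁅ l ⁆
    (subst (0 <_) (sym (∣⁅x⁆∣≡1 l)) (s≤s z≤n)) (subst (_≤ suc k) (sym (∣⁅x⁆∣≡1 l)) (s≤s z≤n)))
  open FireInitialSegment m≥0 D≥0 below-threshold w-label p≤n T-def
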